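{- Let $T = (V,E)$ be a finite simple undirected tree and let $u,v \in V$ with $\mathrm{dist}(u,v) \geq 2$. The inequality $x_{uv} \leq x_{u,\vec{u}(v)} + x_{\vec{u}(v),v}$ defines a facet of $\Xi_T$ if and only if $\mathrm{dist}(u,v) = 2$.
   Context: Let $m = |\binom{V}{2}|$. Vectors $x \in \mathbb{R}^m$ have coordinates $x_{uv} = x_{vu}$ indexed by unordered pairs of distinct nodes; for an edge $e = \{u,v\} \in E$ write $x_e = x_{uv}$. $P_{uv}$ is the unique path in $T$ from $u$ to $v$ and $\mathrm{dist}(u,v)$ its number of edges. $X_T$ is the set of all $x \in \{0,1\}^m$ such that for all $u,v$ with $\mathrm{dist}(u,v) \geq 2$: $x_{uv} \leq \sum_{e \in P_{uv}} x_e$, and $x_e \leq x_{uv}$ for every $e \in P_{uv}$. The lifted multicut polytope is $\Xi_T = \operatorname{conv} X_T$ (it has dimension $m$). For $u,v$ with $\mathrm{dist}(u,v) \geq 2$, $\vec{u}(v)$ denotes the neighbor of $u$ on $P_{uv}$. -}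

module Defs where

open import Data.Nat using (ℕ; zero; suc; _+_; _≤_)
open import Data.Fin using (Fin) renaming (_<_ to _<ᶠ_)
open import Data.Bool using (Bool; true; false)
open import Data.List using (List; []; _∷_; map)
open import Data.Nat.ListAction using (sum)
open import Data.List.Relation.Unary.Unique.Propositional using (Unique)
open import Data.List.Membership.Propositional using (_∈_)
open import Data.Product using (Σ; ∃; _×_; _,_)
open import Data.Rational using (ℚ; 0ℚ; 1ℚ) renaming (_+_ to _+ℚ_; _*_ to _*ℚ_)
open import Relation.Binary.PropositionalEquality using (_≡_; _≢_)

record Graph (n : ℕ) : Set where
  field
    adj     : Fin n → Fin n → Bool
    adj-sym : ∀ u v → adj u v ≡ adj v u
    adj-irr : ∀ u → adj u u ≡ false
open Graph public

data Walk {n : ℕ} (G : Graph n) : Fin n → Fin n → Set where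
  here : ∀ {u} → Walk G u u
  step : ∀ {u w v} → adj G u w ≡ true → Walk G w v → Walk G u v

module _ {n : ℕ} {G : Graph n} where

  vertices : ∀ {u v} → Walk G u v → List (Fin n)
  vertices (here {u})       = u ∷ []
  vertices (step {u} _ p)   = u ∷ vertices p

  len : ∀ {u v} → Walk G u v → ℕ
  len here       = 0
  len (step _ p) = suc (len p)

  edges : ∀ {u v} → Walk G u v → List (Fin n × Fin n)
  edges here                         = []
  edges (step {u} {w} _ p)           = (u , w) ∷ edges p

  -- second vertex of a walk (the neighbour of u on it); junk (= u) for
  -- the empty walk
  second : ∀ {u v} → Walk G u v → Fin n
  second (here {u})       = u
  second (step {w = w} _ _) = w

Path : ∀ {n} (G : Graph n) → Fin n → Fin n → Set
Path G u v = Σ (Walk G u v) (λ p → Unique (vertices p))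

record IsTree {n : ℕ} (G : Graph n) : Set where
  field
    connected  : ∀ u v → Path G u v
    uniquePath : ∀ {u v} (p q : Path G u v) →
                 vertices (Data.Product.proj₁ p) ≡ vertices (Data.Product.proj₁ q)

-- A point is represented by a
-- symmetric function x : Fin n → Fin n → Bool with x u u = false; the
-- coordinate x_{uv} of the unordered pair {u,v} is x u v (= x v u).

Point : ℕ → Set
Point n = Fin n → Fin n → Bool

IsPoint : ∀ {n} → Point n → Set
IsPoint {n} x = (∀ u v → x u v ≡ x v u) × (∀ u → x u u ≡ false)

b2n : Bool → ℕ
b2n true  = 1
b2n false = 0

b2q : Bool → ℚ
b2q true  = 1ℚ
b2q false = 0ℚ

numPairs : ℕ → ℕ
numPairs zero    = 0
numPairs (suc n) = numPairs n + n

record InX {n : ℕ} (G : Graph n) (x : Point n) : Set where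
  field
    isPoint : IsPoint x
    cutUpper : ∀ {u v} (p : Path G u v) → 2 ≤ len (Data.Product.proj₁ p) →
               b2n (x u v) ≤ sum (map (λ e → b2n (x (Data.Product.proj₁ e) (Data.Product.proj₂ e)))
                                      (edges (Data.Product.proj₁ p)))
    cutLower : ∀ {u v} (p : Path G u v) → 2 ≤ len (Data.Product.proj₁ p) →
               ∀ {a b} → (a , b) ∈ edges (Data.Product.proj₁ p) → b2n (x a b) ≤ b2n (x u v)

-- Affine independence over ℚ of a family of k points of {0,1}^m
-- (only the coordinates of unordered pairs {i,j}, i < j, matter).

sumℚ : ∀ {k} → (Fin k → ℚ) → ℚ
sumℚ {zero}  f = 0ℚ
sumℚ {suc k} f = f Fin.zero +ℚ sumℚ (λ i → f (Fin.suc i))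
  where import Data.Fin as Fin

AffinelyIndependent : ∀ {n k} → (Fin k → Point n) → Set
AffinelyIndependent {n} {k} P =
  (c : Fin k → ℚ) →
  sumℚ c ≡ 0ℚ →
  (∀ (i j : Fin n) → i <ᶠ j → sumℚ (λ t → c t *ℚ b2q (P t i j)) ≡ 0ℚ) →
  ∀ t → c t ≡ 0ℚ

-- An inequality  lhs(x) ≤ rhs(x)  (lhs, rhs linear forms with natural
-- coefficients) defines a facet of Ξ_T = conv X_T (a polytope of
-- dimension m): it is valid for X_T (hence for Ξ_T), the face it
-- defines is proper, and this face (= conv of the tight points of X_T)
-- has dimension m - 1, i.e. contains m affinely independent points.

record FacetDefining {n : ℕ} (G : Graph n) (lhs rhs : Point n → ℕ) : Set where
  field
    valid    : ∀ x → InX G x → lhs x ≤ rhs x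
    proper   : ∃ λ x → InX G x × lhs x ≢ rhs x
    dimFace  : Σ (Fin (numPairs n) → Point n) λ P →
                 (∀ t → InX G (P t)) × (∀ t → lhs (P t) ≡ rhs (P t)) ×
                 AffinelyIndependent P

{-# OPTIONS --safe #-}
module Submission where

-- The inequality is a cut constraint of X_T.  For every pair {a,b} ≠ {u,v}
-- take the lifted multicut obtained by cutting the first and the last edge of the a–b path,
-- and take 0 for {u,v}.  In a tree a path of length ≥ 2 is determined by its first and last
-- edge, so no point cuts both uw and wv and all these points are tight.  They are affinely
-- independent by a triangular argument: for a pair {a,b} at distance ≥ 2, with inner
-- neighbours a⁺ and b⁻, the functional x_ab + x_a⁺b⁻ − x_a⁺b − x_ab⁻ vanishes on every point
-- but the one of {a,b}; for an edge ab, x_ab vanishes on the points of all other edge pairs.  On a path u – u′ – w – … – v every tight point of X_T also satisfies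
-- x_uw = x_uu′ + x_u′w, so the tight points satisfy two independent affine equations and
-- cannot contain m affinely independent points.

open import Defs

open import Algebra.Bundles using (CommutativeRing)
open import Data.Bool using (Bool; true; false; _∨_; _∧_; not)
open import Data.Bool.Properties using (∨-comm; ∨-assoc; ∨-identityʳ; ∨-zeroʳ)
open import Data.Empty using (⊥; ⊥-elim)
open import Data.Fin using (Fin; zero; suc; _<_; _≟_; splitAt; _↑ˡ_; _↑ʳ_)
open import Data.Fin.Properties
  using (splitAt-↑ˡ; splitAt-↑ʳ; splitAt⁻¹-↑ˡ; splitAt⁻¹-↑ʳ; suc-injective; <-cmp; <-irrefl; <-asym)
open import Data.List using (List; []; _∷_; _++_; [_]; map; reverse; length; filter; allFin)
open import Data.List.Properties using (unfold-reverse; map-cong-local; length-map; length-++; filter-notAll; length-tabulate)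
open import Data.List.Membership.Propositional using (_∈_; _∉_; find)
open import Data.List.Membership.Propositional.Properties using (∈-++⁺ˡ; ∈-++⁺ʳ; ∈-∃++; ∈-filter⁺; ∈-allFin)
open import Data.List.Relation.Unary.All as All using (All; all?)
import Data.List.Relation.Unary.All.Properties as All
open import Data.List.Relation.Unary.Any as Any using (here; there)
open import Data.List.Relation.Unary.AllPairs as AllPairs using ([]; _∷_)
open import Data.List.Relation.Unary.Unique.Propositional using (Unique)
open import Data.List.Relation.Unary.Unique.Propositional.Properties using (Unique[x∷xs]⇒x∉xs)
open import Data.List.Relation.Binary.Permutation.Propositional using (↭-sym; ↭⇒↭ₛ)
open import Data.List.Relation.Binary.Permutation.Propositional.Properties using (↭-reverse)
import Data.List.Relation.Binary.Permutation.Setoid.Properties as ↭ₛ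
open import Data.Nat as ℕ using (ℕ; zero; suc; _+_; _≤_; z≤n; s≤s; z<s; s<s)
import Data.Nat.Properties as ℕₚ
open import Data.Nat.Properties using (≤-refl; ≤-trans; ≤-reflexive; +-monoʳ-≤; +-suc; module ≤-Reasoning)
open import Data.Nat.ListAction using (sum)
open import Data.Product using (∃; _×_; _,_; proj₁; proj₂; swap)
open import Data.Product.Properties using (,-injective; ≡-dec)
open import Data.Rational using (ℚ; 0ℚ; 1ℚ)
  renaming (_≟_ to _≟ℚ_; _+_ to _+ℚ_; _*_ to _*ℚ_; -_ to -ℚ_)
open import Data.Rational.Properties
  using ( +-*-commutativeRing; heytingCommutativeRing; *-zeroʳ; *-zeroˡ; *-identityˡ; *-identityʳ
        ; *-distribˡ-+; *-assoc; +-identityˡ; +-identityʳ)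
open import Data.Rational.Solver using (module +-*-Solver)
open import Algebra.Apartness.Properties.HeytingCommutativeRing heytingCommutativeRing using (x#0y#0→xy#0)
import Algebra.Properties.Semiring.Sum (CommutativeRing.semiring +-*-commutativeRing) as ℚ-Sum
open import Data.Sum as Sum using (_⊎_; inj₁; inj₂; [_,_]′)
open import Function using (_∘_; id; _⇔_; mk⇔)
open import Relation.Binary using (DecidableEquality; tri<; tri≈; tri>)
open import Relation.Binary.PropositionalEquality hiding ([_])
open import Relation.Nullary using (¬_; ¬?; Dec; yes; no; does; proof; _⊎-dec_)
open import Relation.Nullary.Decidable using (dec-true; does-⇔)
open import Relation.Nullary.Reflects using (Reflects; invert)

open +-*-Solver using (solve; _:+_; _:*_; :-_; _:=_; con)

private
  variable
    k n : ℕ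

module _ {A : Set} where

  Unique-++⁻ˡ : ∀ xs {ys : List A} → Unique (xs ++ ys) → Unique xs
  Unique-++⁻ˡ []       _        = []
  Unique-++⁻ˡ (x ∷ xs) (x∉ ∷ u) = All.++⁻ˡ xs x∉ ∷ Unique-++⁻ˡ xs u

  Unique-++⇒disjoint : ∀ xs {ys : List A} {z} → Unique (xs ++ ys) → z ∈ xs → z ∉ ys
  Unique-++⇒disjoint (x ∷ xs) (x∉ ∷ _) (here refl)  z∈ys = All.lookup (All.++⁻ʳ xs x∉) z∈ys refl
  Unique-++⇒disjoint (x ∷ xs) (_ ∷ u)  (there z∈xs)      = Unique-++⇒disjoint xs u z∈xs

  Unique-reverse⁺ : ∀ {xs : List A} → Unique xs → Unique (reverse xs)
  Unique-reverse⁺ {xs} = ↭ₛ.Unique-resp-↭ (setoid A) (↭⇒↭ₛ (↭-sym (↭-reverse xs)))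

  consecutive : List A → List (A × A)
  consecutive (x ∷ y ∷ xs) = (x , y) ∷ consecutive (y ∷ xs)
  consecutive _            = []

  infix 4 _≅_

  _≅_ : A × A → A × A → Set
  p ≅ q = p ≡ q ⊎ p ≡ swap q

  ≅-sym : {p q : A × A} → p ≅ q → q ≅ p
  ≅-sym (inj₁ refl) = inj₁ refl
  ≅-sym (inj₂ refl) = inj₂ refl

  ≅-trans : {p q r : A × A} → p ≅ q → q ≅ r → p ≅ r
  ≅-trans (inj₁ refl) q≅r         = q≅r
  ≅-trans (inj₂ refl) (inj₁ refl) = inj₂ refl
  ≅-trans (inj₂ refl) (inj₂ refl) = inj₁ refl

  ≅-swapˡ : {p q : A × A} → p ≅ q → swap p ≅ q
  ≅-swapˡ (inj₁ refl) = inj₂ refl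
  ≅-swapˡ (inj₂ refl) = inj₁ refl

  ≅-swapʳ : {p q : A × A} → p ≅ q → p ≅ swap q
  ≅-swapʳ (inj₁ refl) = inj₂ refl
  ≅-swapʳ (inj₂ refl) = inj₁ refl

  fst∉⇒≇ : {x y z w : A} → x ≢ z → x ≢ w → ¬ (x , y) ≅ (z , w)
  fst∉⇒≇ x≢z _   (inj₁ refl) = x≢z refl
  fst∉⇒≇ _   x≢w (inj₂ refl) = x≢w refl

  ≅-dec : DecidableEquality A → (p q : A × A) → Dec (p ≅ q)
  ≅-dec _≟_ p q = ≡-dec _≟_ _≟_ p q ⊎-dec ≡-dec _≟_ _≟_ p (swap q)

b2n≤1 : ∀ x → b2n x ≤ 1
b2n≤1 true  = ≤-refl
b2n≤1 false = z≤n

b2q-+ : ∀ x y {z} → b2n z ≡ b2n x + b2n y → b2q z ≡ b2q x +ℚ b2q y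
b2q-+ true  true  {true}  ()
b2q-+ true  true  {false} ()
b2q-+ true  false {true}  _  = refl
b2q-+ true  false {false} ()
b2q-+ false true  {true}  _  = refl
b2q-+ false true  {false} ()
b2q-+ false false {true}  ()
b2q-+ false false {false} _  = refl

b2n-squeeze : ∀ x y z → b2n x + b2n y ≤ 1 → b2n z ≤ b2n x + b2n y → b2n x ≤ b2n z → b2n y ≤ b2n z →
              b2n z ≡ b2n x + b2n y
b2n-squeeze true  true  _     (s≤s ())
b2n-squeeze true  false true  _ _ _  _  = refl
b2n-squeeze true  false false _ _ () _
b2n-squeeze false true  true  _ _ _  _  = refl
b2n-squeeze false true  false _ _ _  ()
b2n-squeeze false false true  _ () _ _
b2n-squeeze false false false _ _ _  _  = refl

b2n-∨-disjoint : ∀ x y → (x ≡ true → y ≡ true → ⊥) → b2n (x ∨ y) ≡ b2n x + b2n y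
b2n-∨-disjoint true  true  disjoint = ⊥-elim (disjoint refl refl)
b2n-∨-disjoint true  false _        = refl
b2n-∨-disjoint false _     _        = refl

∧-disjoint : ∀ x y z → (x ≡ true → y ≡ true → ⊥) → x ∧ (y ∧ z) ≡ false
∧-disjoint true  true  _ disjoint = ⊥-elim (disjoint refl refl)
∧-disjoint true  false _ _        = refl
∧-disjoint false _     _ _        = refl

b2q-inclusion-exclusion : ∀ x y z →
  b2q (x ∨ (y ∨ z)) +ℚ b2q y +ℚ b2q (x ∧ (z ∧ not y)) ≡ b2q (y ∨ z) +ℚ b2q (x ∨ y)
b2q-inclusion-exclusion true  true  true  = refl
b2q-inclusion-exclusion true  true  false = refl
b2q-inclusion-exclusion true  false true  = refl
b2q-inclusion-exclusion true  false false = refl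
b2q-inclusion-exclusion false true  true  = refl
b2q-inclusion-exclusion false true  false = refl
b2q-inclusion-exclusion false false true  = refl
b2q-inclusion-exclusion false false false = refl

-- Walks

module Walks {G : Graph n} where

  private
    variable
      a b c : Fin n

  adj-swap : adj G a b ≡ true → adj G b a ≡ true
  adj-swap {a} {b} e = trans (adj-sym G b a) e

  adj⇒≢ : adj G a b ≡ true → a ≢ b
  adj⇒≢ {a} e refl with () ← trans (sym e) (adj-irr G a)

  start∈vertices : (p : Walk G a b) → a ∈ vertices p
  start∈vertices here       = here refl
  start∈vertices (step _ _) = here refl

  end∈vertices : (p : Walk G a b) → b ∈ vertices p
  end∈vertices here       = here refl
  end∈vertices (step _ p) = there (end∈vertices p)

  ∈-edges⇒adj : ∀ {x y} (p : Walk G a b) → (x , y) ∈ edges p → adj G x y ≡ true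
  ∈-edges⇒adj (step e _) (here refl)  = e
  ∈-edges⇒adj (step _ p) (there xy∈) = ∈-edges⇒adj p xy∈

  ∈-edges⇒∈-vertices : ∀ {x y} (p : Walk G a b) → (x , y) ∈ edges p → x ∈ vertices p × y ∈ vertices p
  ∈-edges⇒∈-vertices (step _ p) (here refl)  = here refl , there (start∈vertices p)
  ∈-edges⇒∈-vertices (step _ p) (there xy∈) with x∈ , y∈ ← ∈-edges⇒∈-vertices p xy∈ = there x∈ , there y∈

  edges≡consecutive : (p : Walk G a b) → edges p ≡ consecutive (vertices p)
  edges≡consecutive here                = refl
  edges≡consecutive (step _ here)       = refl
  edges≡consecutive (step _ (step e p)) = cong (_ ∷_) (edges≡consecutive (step e p))

  vertices⇒edges : ∀ {a′ b′} (p : Walk G a b) (q : Walk G a′ b′) → vertices p ≡ vertices q → edges p ≡ edges q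
  vertices⇒edges p q eq = trans (edges≡consecutive p) (trans (cong consecutive eq) (sym (edges≡consecutive q)))

  snoc : Walk G a b → adj G b c ≡ true → Walk G a c
  snoc here       e = step e here
  snoc (step e p) f = step e (snoc p f)

  vertices-snoc : (p : Walk G a b) (e : adj G b c ≡ true) → vertices (snoc p e) ≡ vertices p ++ [ c ]
  vertices-snoc here       _ = refl
  vertices-snoc (step _ p) e = cong (_ ∷_) (vertices-snoc p e)

  edges-snoc : (p : Walk G a b) (e : adj G b c ≡ true) → edges (snoc p e) ≡ edges p ++ [ (b , c) ]
  edges-snoc here       _ = refl
  edges-snoc (step _ p) e = cong (_ ∷_) (edges-snoc p e)

  penultimate : Walk G a b → Fin n
  penultimate (here {a})          = a
  penultimate (step {u} _ here)   = u
  penultimate (step _ (step e p)) = penultimate (step e p)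

  penultimate-snoc : (p : Walk G a b) (e : adj G b c ≡ true) → penultimate (snoc p e) ≡ b
  penultimate-snoc here                _ = refl
  penultimate-snoc (step _ here)       _ = refl
  penultimate-snoc (step _ (step f p)) e = penultimate-snoc (step f p) e

  reverseWalk : Walk G a b → Walk G b a
  reverseWalk here       = here
  reverseWalk (step e p) = snoc (reverseWalk p) (adj-swap e)

  reverseWalk-snoc : (p : Walk G a b) (e : adj G b c ≡ true) → reverseWalk (snoc p e) ≡ step (adj-swap e) (reverseWalk p)
  reverseWalk-snoc here       _ = refl
  reverseWalk-snoc (step f p) e = cong (λ q → snoc q (adj-swap f)) (reverseWalk-snoc p e)

  vertices-reverseWalk : (p : Walk G a b) → vertices (reverseWalk p) ≡ reverse (vertices p)
  vertices-reverseWalk here = refl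
  vertices-reverseWalk (step {u} e p) = begin
    vertices (snoc (reverseWalk p) (adj-swap e)) ≡⟨ vertices-snoc (reverseWalk p) (adj-swap e) ⟩
    vertices (reverseWalk p) ++ [ u ]            ≡⟨ cong (_++ [ u ]) (vertices-reverseWalk p) ⟩
    reverse (vertices p) ++ [ u ]                ≡⟨ unfold-reverse u (vertices p) ⟨
    reverse (u ∷ vertices p)                     ∎
    where open ≡-Reasoning

  edges-reverseWalk : (p : Walk G a b) → edges (reverseWalk p) ≡ reverse (map swap (edges p))
  edges-reverseWalk here = refl
  edges-reverseWalk (step {u} {w} e p) = begin
    edges (snoc (reverseWalk p) (adj-swap e))   ≡⟨ edges-snoc (reverseWalk p) (adj-swap e) ⟩
    edges (reverseWalk p) ++ [ (w , u) ]        ≡⟨ cong (_++ [ (w , u) ]) (edges-reverseWalk p) ⟩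
    reverse (map swap (edges p)) ++ [ (w , u) ] ≡⟨ unfold-reverse (w , u) (map swap (edges p)) ⟨
    reverse (map swap ((u , w) ∷ edges p))      ∎
    where open ≡-Reasoning

  reversePath : Path G a b → Path G b a
  reversePath (p , u) = reverseWalk p , subst Unique (sym (vertices-reverseWalk p)) (Unique-reverse⁺ u)

  data Shape (p : Walk G a b) : Set where
    edge : (e : adj G a b ≡ true) → p ≡ step e here → Shape p
    long : ∀ {a⁺ b⁻} (eA : adj G a a⁺ ≡ true) (mid : Walk G a⁺ b⁻) (eB : adj G b⁻ b ≡ true) →
           p ≡ step eA (snoc mid eB) → Shape p

  shape-step : ∀ {w} (e : adj G a w ≡ true) (p : Walk G w b) → Shape (step e p)
  shape-step e here       = edge e refl
  shape-step e (step f p) with shape-step f p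
  ... | edge f′ eq        = long e here f′ (cong (step e) eq)
  ... | long fA mid fB eq = long e (step fA mid) fB (cong (step e) eq)

  shape : (p : Walk G a b) → a ≢ b → Shape p
  shape here       a≢a = ⊥-elim (a≢a refl)
  shape (step e p) _   = shape-step e p

  module LongPath {a⁺ b⁻ : Fin n} (eA : adj G a a⁺ ≡ true) (mid : Walk G a⁺ b⁻) (eB : adj G b⁻ b ≡ true)
                  (unique : Unique (vertices (step eA (snoc mid eB)))) where

    unique′ : Unique (a ∷ vertices mid ++ [ b ])
    unique′ = subst (λ vs → Unique (a ∷ vs)) (vertices-snoc mid eB) unique

    a∉mid : a ∉ vertices mid
    a∉mid a∈ = Unique[x∷xs]⇒x∉xs unique′ (∈-++⁺ˡ a∈)

    b∉mid : b ∉ vertices mid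
    b∉mid b∈ = Unique-++⇒disjoint (vertices mid) (AllPairs.tail unique′) b∈ (here refl)

    a≢b : a ≢ b
    a≢b refl = Unique[x∷xs]⇒x∉xs unique′ (∈-++⁺ʳ (vertices mid) (here refl))

    a≢b⁻ : a ≢ b⁻
    a≢b⁻ refl = a∉mid (end∈vertices mid)

    a∉tail : a ∉ vertices (snoc mid eB)
    a∉tail = Unique[x∷xs]⇒x∉xs unique

    b∉init : b ∉ vertices (step eA mid)
    b∉init (here b≡a) = a≢b (sym b≡a)
    b∉init (there b∈) = b∉mid b∈

    a⁺∈ : a⁺ ∈ vertices (step eA (snoc mid eB))
    a⁺∈ = there (start∈vertices (snoc mid eB))

    b⁻∈ : b⁻ ∈ vertices (step eA (snoc mid eB))
    b⁻∈ = there (subst (b⁻ ∈_) (sym (vertices-snoc mid eB)) (∈-++⁺ˡ (end∈vertices mid)))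

    whole : Path G a b
    whole = step eA (snoc mid eB) , unique

    tailPath : Path G a⁺ b
    tailPath = snoc mid eB , AllPairs.tail unique

    initPath : Path G a b⁻
    initPath = step eA mid , Unique-++⁻ˡ (a ∷ vertices mid) unique′

    midPath : Path G a⁺ b⁻
    midPath = mid , Unique-++⁻ˡ (vertices mid) (AllPairs.tail unique′)

    reversed : Unique (vertices (step (adj-swap eB) (snoc (reverseWalk mid) (adj-swap eA))))
    reversed = subst (Unique ∘ vertices) (cong (λ q → snoc q (adj-swap eA)) (reverseWalk-snoc mid eB))
                     (proj₂ (reversePath whole))

  EndEdge : Walk G a b → Fin n × Fin n → Set
  EndEdge {a} {b} p e = e ≅ (a , second p) ⊎ e ≅ (penultimate p , b)

  EndEdge? : (p : Walk G a b) (e : Fin n × Fin n) → Dec (EndEdge p e)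
  EndEdge? p e = ≅-dec _≟_ e _ ⊎-dec ≅-dec _≟_ e _

  EndEdge-swap : ∀ {x y} (p : Walk G a b) → EndEdge p (x , y) → EndEdge p (y , x)
  EndEdge-swap _ = Sum.map ≅-swapˡ ≅-swapˡ

  EndEdge-edge : ∀ {e} (f : adj G a b ≡ true) → EndEdge (step f here) e → e ≅ (a , b)
  EndEdge-edge _ = [ id , id ]′

  module _ {a⁺ b⁻ : Fin n} {e : Fin n × Fin n} (eA : adj G a a⁺ ≡ true) (mid : Walk G a⁺ b⁻) (eB : adj G b⁻ b ≡ true) where

    EndEdge-long⁻ : EndEdge (step eA (snoc mid eB)) e → e ≅ (a , a⁺) ⊎ e ≅ (b⁻ , b)
    EndEdge-long⁻ = Sum.map₂ (subst (λ z → e ≅ (z , b)) (penultimate-snoc (step eA mid) eB))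

    EndEdge-long⁺ : e ≅ (a , a⁺) ⊎ e ≅ (b⁻ , b) → EndEdge (step eA (snoc mid eB)) e
    EndEdge-long⁺ = Sum.map₂ (subst (λ z → e ≅ (z , b)) (sym (penultimate-snoc (step eA mid) eB)))

-- Lifted multicuts of a tree

EdgeSet : ℕ → Set
EdgeSet n = Fin n → Fin n → Bool

Undirected : EdgeSet n → Set
Undirected S = ∀ x y → S x y ≡ S y x

anyEdge : EdgeSet n → List (Fin n × Fin n) → Bool
anyEdge S []             = false
anyEdge S ((x , y) ∷ es) = S x y ∨ anyEdge S es

module _ (S : EdgeSet n) where

  anyEdge-++ : ∀ es fs → anyEdge S (es ++ fs) ≡ anyEdge S es ∨ anyEdge S fs
  anyEdge-++ []             fs = refl
  anyEdge-++ ((x , y) ∷ es) fs = trans (cong (S x y ∨_) (anyEdge-++ es fs)) (sym (∨-assoc (S x y) _ _))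

  anyEdge-snoc : ∀ es x y → anyEdge S (es ++ [ (x , y) ]) ≡ anyEdge S es ∨ S x y
  anyEdge-snoc es x y = trans (anyEdge-++ es _) (cong (anyEdge S es ∨_) (∨-identityʳ (S x y)))

  anyEdge-reverse : Undirected S → ∀ es → anyEdge S (reverse (map swap es)) ≡ anyEdge S es
  anyEdge-reverse undirected [] = refl
  anyEdge-reverse undirected ((x , y) ∷ es) = begin
    anyEdge S (reverse ((y , x) ∷ map swap es))      ≡⟨ cong (anyEdge S) (unfold-reverse (y , x) (map swap es)) ⟩
    anyEdge S (reverse (map swap es) ++ [ (y , x) ]) ≡⟨ anyEdge-snoc (reverse (map swap es)) y x ⟩
    anyEdge S (reverse (map swap es)) ∨ S y x        ≡⟨ cong (_∨ S y x) (anyEdge-reverse undirected es) ⟩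
    anyEdge S es ∨ S y x                             ≡⟨ ∨-comm (anyEdge S es) (S y x) ⟩
    S y x ∨ anyEdge S es                             ≡⟨ cong (_∨ anyEdge S es) (undirected y x) ⟩
    S x y ∨ anyEdge S es                             ∎
    where open ≡-Reasoning

  anyEdge-true : ∀ {x y} es → (x , y) ∈ es → S x y ≡ true → anyEdge S es ≡ true
  anyEdge-true ((x , y) ∷ es) (here refl)  Sxy rewrite Sxy = refl
  anyEdge-true ((x , y) ∷ es) (there xy∈) Sxy rewrite anyEdge-true es xy∈ Sxy = ∨-zeroʳ (S x y)

  anyEdge-false : ∀ es → (∀ {x y} → (x , y) ∈ es → S x y ≡ false) → anyEdge S es ≡ false
  anyEdge-false []             _       = refl
  anyEdge-false ((x , y) ∷ es) ∉S rewrite ∉S (here refl) = anyEdge-false es (∉S ∘ there)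

  b2n-anyEdge≤sum : ∀ es → b2n (anyEdge S es) ≤ sum (map (λ e → b2n (S (proj₁ e) (proj₂ e))) es)
  b2n-anyEdge≤sum []             = z≤n
  b2n-anyEdge≤sum ((x , y) ∷ es) = ≤-trans (b2n-∨ (S x y) _) (+-monoʳ-≤ (b2n (S x y)) (b2n-anyEdge≤sum es))
    where
      b2n-∨ : ∀ p q → b2n (p ∨ q) ≤ b2n p + b2n q
      b2n-∨ true  _ = s≤s z≤n
      b2n-∨ false _ = ≤-refl

module Tree {G : Graph n} (tree : IsTree G) where

  open IsTree tree
  open Walks {G = G}

  private
    variable
      a b : Fin n

  walk : (a b : Fin n) → Walk G a b
  walk a b = proj₁ (connected a b)

  edges-path : (p : Path G a b) → edges (proj₁ p) ≡ edges (walk a b)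
  edges-path p = vertices⇒edges _ _ (uniquePath p (connected _ _))

  edgePath : adj G a b ≡ true → Path G a b
  edgePath e = step e here , (adj⇒≢ e All.∷ All.[]) ∷ All.[] ∷ []

  -- The lifted multicut of the decomposition of T into the components of T − S.
  cutPoint : EdgeSet n → Point n
  cutPoint S a b = anyEdge S (edges (walk a b))

  module _ (S : EdgeSet n) where

    cutPoint-path : (p : Path G a b) → cutPoint S a b ≡ anyEdge S (edges (proj₁ p))
    cutPoint-path p = cong (anyEdge S) (sym (edges-path p))

    cutPoint-edge : adj G a b ≡ true → cutPoint S a b ≡ S a b
    cutPoint-edge {a} {b} e = trans (cutPoint-path (edgePath e)) (∨-identityʳ (S a b))

    cutPoint-diag : ∀ a → cutPoint S a a ≡ false
    cutPoint-diag a = cutPoint-path (here , All.[] ∷ [])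

    cutPoint-sym : Undirected S → ∀ a b → cutPoint S a b ≡ cutPoint S b a
    cutPoint-sym undirected a b = begin
      cutPoint S a b                                     ≡⟨ cutPoint-path (reversePath (connected b a)) ⟩
      anyEdge S (edges (reverseWalk (walk b a)))         ≡⟨ cong (anyEdge S) (edges-reverseWalk (walk b a)) ⟩
      anyEdge S (reverse (map swap (edges (walk b a))))  ≡⟨ anyEdge-reverse S undirected (edges (walk b a)) ⟩
      cutPoint S b a                                     ∎
      where open ≡-Reasoning

    cutPoint∈X : Undirected S → InX G (cutPoint S)
    cutPoint∈X undirected = record
      { isPoint  = cutPoint-sym undirected , cutPoint-diag
      ; cutUpper = λ p _ → upper p
      ; cutLower = λ p _ → lower p
      }
      where
        S≗cutPoint : ∀ {a b} (p : Walk G a b) →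
                     map (λ e → b2n (S (proj₁ e) (proj₂ e))) (edges p) ≡
                     map (λ e → b2n (cutPoint S (proj₁ e) (proj₂ e))) (edges p)
        S≗cutPoint p = map-cong-local (All.tabulate λ e∈ → cong b2n (sym (cutPoint-edge (∈-edges⇒adj p e∈))))

        upper : ∀ {a b} (p : Path G a b) →
                b2n (cutPoint S a b) ≤ sum (map (λ e → b2n (cutPoint S (proj₁ e) (proj₂ e))) (edges (proj₁ p)))
        upper (p , u) rewrite cutPoint-path (p , u) | sym (S≗cutPoint p) = b2n-anyEdge≤sum S (edges p)

        lower : ∀ {a b x y} (p : Path G a b) → (x , y) ∈ edges (proj₁ p) → b2n (cutPoint S x y) ≤ b2n (cutPoint S a b)
        lower {x = x} {y} (p , u) xy∈ rewrite cutPoint-edge (∈-edges⇒adj p xy∈) | cutPoint-path (p , u) with S x y in Sxy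
        ... | false = z≤n
        ... | true  rewrite anyEdge-true S (edges p) xy∈ Sxy = ≤-refl

  private
    transport∈ : ∀ {x} (p q : Path G a b) → x ∈ vertices (proj₁ p) → x ∈ vertices (proj₁ q)
    transport∈ p q = subst (_ ∈_) (uniquePath p q)

  firstLast⇒sameEnds :
    ∀ {a a⁺ b⁻ b c c⁺ d⁻ d}
      (eA : adj G a a⁺ ≡ true) (mid : Walk G a⁺ b⁻) (eB : adj G b⁻ b ≡ true) → Unique (vertices (step eA (snoc mid eB))) →
      (fA : adj G c c⁺ ≡ true) (mid′ : Walk G c⁺ d⁻) (fB : adj G d⁻ d ≡ true) → Unique (vertices (step fA (snoc mid′ fB))) →
      (a , a⁺) ≅ (c , c⁺) → (b⁻ , b) ≅ (d⁻ , d) → (a , b) ≡ (c , d)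
  firstLast⇒sameEnds {a} {a⁺} {b⁻} {b} {c} {c⁺} {d⁻} {d} eA mid eB uR fA mid′ fB uQ = cases
    where
      module R = LongPath eA mid eB uR
      module Q = LongPath fA mid′ fB uQ
      cases : (a , a⁺) ≅ (c , c⁺) → (b⁻ , b) ≅ (d⁻ , d) → (a , b) ≡ (c , d)
      cases (inj₁ refl) (inj₁ refl) = refl
      cases (inj₁ refl) (inj₂ refl) = ⊥-elim (Q.b∉init (transport∈ R.whole Q.initPath R.b⁻∈))
      cases (inj₂ refl) (inj₁ refl) = ⊥-elim (Q.a∉tail (transport∈ R.whole Q.tailPath R.a⁺∈))
      cases (inj₂ refl) (inj₂ refl) = ⊥-elim (Q.a∉mid (transport∈ R.whole Q.midPath R.a⁺∈))

  EndEdge⇒sameEnds :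
    ∀ {a a⁺ b⁻ b c d}
      (eA : adj G a a⁺ ≡ true) (mid : Walk G a⁺ b⁻) (eB : adj G b⁻ b ≡ true) → Unique (vertices (step eA (snoc mid eB))) →
      (q : Walk G c d) → Shape q → Unique (vertices q) →
      EndEdge q (a , a⁺) → EndEdge q (b⁻ , b) → (c , d) ≅ (a , b)
  EndEdge⇒sameEnds eA mid eB uR _ (edge f refl) _ endA endB =
    ⊥-elim (fst∉⇒≇ R.a≢b⁻ R.a≢b (≅-trans (EndEdge-edge f endA) (≅-sym (EndEdge-edge f endB))))
    where module R = LongPath eA mid eB uR
  EndEdge⇒sameEnds {a} {a⁺} {b⁻} {b} {c} {d} eA mid eB uR _ (long {a⁺ = c⁺} {b⁻ = d⁻} fA mid′ fB refl) uQ endA endB =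
    cases (EndEdge-long⁻ fA mid′ fB endA) (EndEdge-long⁻ fA mid′ fB endB)
    where
      module R = LongPath eA mid eB uR
      module Q = LongPath fA mid′ fB uQ
      cases : (a , a⁺) ≅ (c , c⁺) ⊎ (a , a⁺) ≅ (d⁻ , d) → (b⁻ , b) ≅ (c , c⁺) ⊎ (b⁻ , b) ≅ (d⁻ , d) → (c , d) ≅ (a , b)
      cases (inj₁ first) (inj₂ last)   = inj₁ (sym (firstLast⇒sameEnds eA mid eB uR fA mid′ fB uQ first last))
      cases (inj₂ last)  (inj₁ first)  = inj₂ (cong swap (sym
        (firstLast⇒sameEnds eA mid eB uR (adj-swap fB) (reverseWalk mid′) (adj-swap fA) Q.reversed (≅-swapʳ last) (≅-swapʳ first))))
      cases (inj₁ first) (inj₁ first′) = ⊥-elim (fst∉⇒≇ R.a≢b⁻ R.a≢b (≅-trans first (≅-sym first′)))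
      cases (inj₂ last)  (inj₂ last′)  = ⊥-elim (fst∉⇒≇ R.a≢b⁻ R.a≢b (≅-trans last (≅-sym last′)))

  endEdges : Fin n → Fin n → EdgeSet n
  endEdges c d x y = does (EndEdge? (walk c d) (x , y))

  endEdges-undirected : ∀ c d → Undirected (endEdges c d)
  endEdges-undirected c d x y =
    does-⇔ (mk⇔ (EndEdge-swap (walk c d)) (EndEdge-swap (walk c d))) (EndEdge? (walk c d) (x , y)) (EndEdge? (walk c d) (y , x))

  endEdges⁺ : ∀ {c d x y} → EndEdge (walk c d) (x , y) → endEdges c d x y ≡ true
  endEdges⁺ {c} {d} {x} {y} = dec-true (EndEdge? (walk c d) (x , y))

  endEdges⁻ : ∀ {c d x y} → endEdges c d x y ≡ true → EndEdge (walk c d) (x , y)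
  endEdges⁻ {c} {d} {x} {y} xy∈ = invert (subst (Reflects _) xy∈ (proof (EndEdge? (walk c d) (x , y))))

  endEdges⇒sameEnds :
    ∀ {a a⁺ b⁻ b c d}
      (eA : adj G a a⁺ ≡ true) (mid : Walk G a⁺ b⁻) (eB : adj G b⁻ b ≡ true) → Unique (vertices (step eA (snoc mid eB))) →
      c ≢ d → endEdges c d a a⁺ ≡ true → endEdges c d b⁻ b ≡ true → (c , d) ≅ (a , b)
  endEdges⇒sameEnds {c = c} {d} eA mid eB uR c≢d endA endB =
    EndEdge⇒sameEnds eA mid eB uR (walk c d) (shape (walk c d) c≢d) (proj₂ (connected c d)) (endEdges⁻ endA) (endEdges⁻ endB)

-- Finite sums and linear algebra over ℚ

sumℚ≡sum : (f : Fin k → ℚ) → sumℚ f ≡ ℚ-Sum.sum f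
sumℚ≡sum {zero}  _ = refl
sumℚ≡sum {suc k} f = cong (f zero +ℚ_) (sumℚ≡sum (f ∘ suc))

sumℚ-cong : {f g : Fin k → ℚ} → (∀ t → f t ≡ g t) → sumℚ f ≡ sumℚ g
sumℚ-cong {f = f} {g} f≗g = trans (sumℚ≡sum f) (trans (ℚ-Sum.sum-cong-≗ f≗g) (sym (sumℚ≡sum g)))

sumℚ-zero : {f : Fin k → ℚ} → (∀ t → f t ≡ 0ℚ) → sumℚ f ≡ 0ℚ
sumℚ-zero {k} f≗0 = trans (sumℚ-cong f≗0) (trans (sumℚ≡sum {k} (λ _ → 0ℚ)) (ℚ-Sum.sum-replicate-zero k))

sumℚ-+ : (f g : Fin k → ℚ) → sumℚ (λ t → f t +ℚ g t) ≡ sumℚ f +ℚ sumℚ g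
sumℚ-+ f g =
  trans (sumℚ≡sum (λ t → f t +ℚ g t)) (trans (ℚ-Sum.∑-distrib-+ f g) (sym (cong₂ _+ℚ_ (sumℚ≡sum f) (sumℚ≡sum g))))

sumℚ-*ˡ : ∀ x (f : Fin k → ℚ) → sumℚ (λ t → x *ℚ f t) ≡ x *ℚ sumℚ f
sumℚ-*ˡ x f = trans (sumℚ≡sum (λ t → x *ℚ f t)) (sym (trans (cong (x *ℚ_) (sumℚ≡sum f)) (ℚ-Sum.*-distribˡ-sum x f)))

sumℚ-single : ∀ (f : Fin k → ℚ) t₀ → (∀ t → t ≢ t₀ → f t ≡ 0ℚ) → sumℚ f ≡ f t₀
sumℚ-single f zero     f≗0 = trans (cong (f zero +ℚ_) (sumℚ-zero (λ t → f≗0 (suc t) λ ()))) (+-identityʳ (f zero))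
sumℚ-single f (suc t₀) f≗0 =
  trans (cong₂ _+ℚ_ (f≗0 zero λ ()) (sumℚ-single (f ∘ suc) t₀ (λ t t≢t₀ → f≗0 (suc t) (t≢t₀ ∘ suc-injective))))
        (+-identityˡ (f (suc t₀)))

infix 7 _·_

_·_ : (Fin k → ℚ) → (Fin k → ℚ) → ℚ
c · f = sumℚ (λ t → c t *ℚ f t)

·-+ : (c f g : Fin k → ℚ) → c · (λ t → f t +ℚ g t) ≡ c · f +ℚ c · g
·-+ c f g = trans (sumℚ-cong λ t → *-distribˡ-+ (c t) (f t) (g t)) (sumℚ-+ (λ t → c t *ℚ f t) (λ t → c t *ℚ g t))

·-relation : ∀ (c f g h f′ g′ : Fin k → ℚ) → (∀ t → f t +ℚ g t +ℚ h t ≡ f′ t +ℚ g′ t) →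
             c · f ≡ 0ℚ → c · g ≡ 0ℚ → c · f′ ≡ 0ℚ → c · g′ ≡ 0ℚ → c · h ≡ 0ℚ
·-relation c f g h f′ g′ relation c⊥f c⊥g c⊥f′ c⊥g′ = begin
  c · h                                ≡⟨ +-identityˡ (c · h) ⟨
  0ℚ +ℚ c · h                          ≡⟨ cong (_+ℚ c · h) (cong₂ _+ℚ_ c⊥f c⊥g) ⟨
  c · f +ℚ c · g +ℚ c · h              ≡⟨ cong (_+ℚ c · h) (·-+ c f g) ⟨
  c · (λ t → f t +ℚ g t) +ℚ c · h      ≡⟨ ·-+ c (λ t → f t +ℚ g t) h ⟨
  c · (λ t → f t +ℚ g t +ℚ h t)        ≡⟨ sumℚ-cong (λ t → cong (c t *ℚ_) (relation t)) ⟩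
  c · (λ t → f′ t +ℚ g′ t)             ≡⟨ ·-+ c f′ g′ ⟩
  c · f′ +ℚ c · g′                     ≡⟨ cong₂ _+ℚ_ c⊥f′ c⊥g′ ⟩
  0ℚ                                   ∎
  where open ≡-Reasoning

·-isolate : ∀ (c f : Fin k → ℚ) t₀ → (∀ t → t ≢ t₀ → c t *ℚ f t ≡ 0ℚ) → f t₀ ≡ 1ℚ → c · f ≡ 0ℚ → c t₀ ≡ 0ℚ
·-isolate c f t₀ others f₀≡1 c·f≡0 = begin
  c t₀             ≡⟨ *-identityʳ (c t₀) ⟨
  c t₀ *ℚ 1ℚ       ≡⟨ cong (c t₀ *ℚ_) f₀≡1 ⟨
  c t₀ *ℚ f t₀     ≡⟨ sumℚ-single (λ t → c t *ℚ f t) t₀ others ⟨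
  c · f            ≡⟨ c·f≡0 ⟩
  0ℚ               ∎
  where open ≡-Reasoning

module Elimination {N : ℕ} (g : Fin (suc N) → ℚ) where

  eliminate : (Fin (suc N) → ℚ) → Fin N → ℚ
  eliminate f t = g zero *ℚ f (suc t) +ℚ -ℚ (f zero *ℚ g (suc t))

  eliminate-self : ∀ (d : Fin N → ℚ) → d · eliminate g ≡ 0ℚ
  eliminate-self d = sumℚ-zero λ t →
    solve 3 (λ x y z → x :* (y :* z :+ :- (y :* z)) := con 0ℚ) refl (d t) (g zero) (g (suc t))

  extend : (Fin N → ℚ) → Fin (suc N) → ℚ
  extend d zero    = -ℚ (d · (g ∘ suc))
  extend d (suc t) = g zero *ℚ d t

  extend-· : ∀ d f → extend d · f ≡ d · eliminate f
  extend-· d f = begin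
    extend d · f
      ≡⟨ cong (-ℚ (d · g′) *ℚ f zero +ℚ_)
              (trans (sumℚ-cong λ t → *-assoc (g zero) (d t) (f (suc t))) (sumℚ-*ˡ (g zero) (λ t → d t *ℚ f′ t))) ⟩
    -ℚ (d · g′) *ℚ f zero +ℚ g zero *ℚ (d · f′)
      ≡⟨ solve 4 (λ x y z w → :- x :* y :+ z :* w := z :* w :+ :- y :* x) refl (d · g′) (f zero) (g zero) (d · f′) ⟩
    g zero *ℚ (d · f′) +ℚ -ℚ (f zero) *ℚ (d · g′)
      ≡⟨ cong₂ _+ℚ_ (sumℚ-*ˡ (g zero) (λ t → d t *ℚ f′ t)) (sumℚ-*ˡ (-ℚ f zero) (λ t → d t *ℚ g′ t)) ⟨
    sumℚ (λ t → g zero *ℚ (d t *ℚ f′ t)) +ℚ sumℚ (λ t → -ℚ (f zero) *ℚ (d t *ℚ g′ t))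
      ≡⟨ sumℚ-+ (λ t → g zero *ℚ (d t *ℚ f′ t)) (λ t → -ℚ (f zero) *ℚ (d t *ℚ g′ t)) ⟨
    sumℚ (λ t → g zero *ℚ (d t *ℚ f′ t) +ℚ -ℚ (f zero) *ℚ (d t *ℚ g′ t))
      ≡⟨ sumℚ-cong (λ t → solve 5 (λ x y z u v → y :* (x :* z) :+ :- u :* (x :* v) := x :* (y :* z :+ :- (u :* v)))
                                  refl (d t) (g zero) (f′ t) (f zero) (g′ t)) ⟩
    d · eliminate f
      ∎
    where
      open ≡-Reasoning
      g′ f′ : Fin N → ℚ
      g′ = g ∘ suc
      f′ = f ∘ suc

unit₀ : Fin (suc k) → ℚ
unit₀ zero    = 1ℚ
unit₀ (suc _) = 0ℚ

unit₀-· : (f : Fin (suc k) → ℚ) → unit₀ · f ≡ f zero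
unit₀-· {k} f = trans (cong₂ _+ℚ_ (*-identityˡ (f zero)) (sumℚ-zero {k} λ t → *-zeroˡ (f (suc t)))) (+-identityʳ (f zero))

NonzeroSolution : List (Fin k → ℚ) → Set
NonzeroSolution {k} F = ∃ λ (c : Fin k → ℚ) → (∃ λ t → c t ≢ 0ℚ) × All (λ f → c · f ≡ 0ℚ) F

underdetermined⇒nonzeroSolution : ∀ N (F : List (Fin N → ℚ)) → length F ℕ.< N → NonzeroSolution F
underdetermined⇒nonzeroSolution (suc N) F |F|<N with all? (λ f → f zero ≟ℚ 0ℚ) F
... | yes F₀≡0 = unit₀ , (zero , λ ()) , All.map (λ {f} f₀≡0 → trans (unit₀-· f) f₀≡0) F₀≡0
... | no ¬F₀≡0
  with g , g∈F , g₀≢0 ← find (All.¬All⇒Any¬ (λ f → f zero ≟ℚ 0ℚ) F ¬F₀≡0)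
  with xs , ys , refl ← ∈-∃++ g∈F = lift (underdetermined⇒nonzeroSolution N (map eliminate (xs ++ ys)) fewer)
  where
    open Elimination g

    fewer : length (map eliminate (xs ++ ys)) ℕ.< N
    fewer = begin-strict
      length (map eliminate (xs ++ ys)) ≡⟨ length-map eliminate (xs ++ ys) ⟩
      length (xs ++ ys)                 ≡⟨ length-++ xs ⟩
      length xs + length ys             <⟨ ℕ.s<s⁻¹ (subst (ℕ._< suc N) (trans (length-++ xs) (+-suc _ _)) |F|<N) ⟩
      N                                 ∎
      where open ≤-Reasoning

    lift : NonzeroSolution (map eliminate (xs ++ ys)) → NonzeroSolution (xs ++ [ g ] ++ ys)
    lift (d , (t , dₜ≢0) , d⊥) = extend d , (suc t , x#0y#0→xy#0 g₀≢0 dₜ≢0) , All.map (λ {f} → trans (extend-· d f)) d⊥all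
      where
        d⊥all : All (λ f → d · eliminate f ≡ 0ℚ) (xs ++ [ g ] ++ ys)
        d⊥all = All.++⁺ (All.++⁻ˡ xs (All.map⁻ d⊥)) (eliminate-self d All.∷ All.++⁻ʳ xs (All.map⁻ d⊥))

-- Coordinates and affine independence

pairAt : ∀ n → Fin (numPairs n) → Fin n × Fin n
pairAt (suc n) t with splitAt (numPairs n) t
... | inj₁ s = suc (proj₁ (pairAt n s)) , suc (proj₂ (pairAt n s))
... | inj₂ j = zero , suc j

pairAt-< : ∀ n t → proj₁ (pairAt n t) < proj₂ (pairAt n t)
pairAt-< (suc n) t with splitAt (numPairs n) t
... | inj₁ s = s<s (pairAt-< n s)
... | inj₂ j = z<s

pairAt-≢ : ∀ n t → proj₁ (pairAt n t) ≢ proj₂ (pairAt n t)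
pairAt-≢ n t eq = <-irrefl eq (pairAt-< n t)

pairAt-injective : ∀ n {s t} → pairAt n s ≡ pairAt n t → s ≡ t
pairAt-injective (suc n) {s} {t} eq with splitAt (numPairs n) s in eqs | splitAt (numPairs n) t in eqt
... | inj₁ s′ | inj₁ t′ =
  let s₁≡t₁ , s₂≡t₂ = ,-injective eq in
  trans (sym (splitAt⁻¹-↑ˡ eqs))
        (trans (cong (_↑ˡ n) (pairAt-injective n (cong₂ _,_ (suc-injective s₁≡t₁) (suc-injective s₂≡t₂))))
               (splitAt⁻¹-↑ˡ eqt))
... | inj₂ i | inj₂ j =
  trans (sym (splitAt⁻¹-↑ʳ eqs)) (trans (cong (numPairs n ↑ʳ_) (suc-injective (cong proj₂ eq))) (splitAt⁻¹-↑ʳ eqt))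
... | inj₁ _ | inj₂ _ with () ← cong proj₁ eq
... | inj₂ _ | inj₁ _ with () ← cong proj₁ eq

pairAt-surjective : ∀ n {i j : Fin n} → i < j → ∃ λ t → pairAt n t ≡ (i , j)
pairAt-surjective (suc n) {zero} {suc j} _ = numPairs n ↑ʳ j , pairAt-↑ʳ
  where
    pairAt-↑ʳ : pairAt (suc n) (numPairs n ↑ʳ j) ≡ (zero , suc j)
    pairAt-↑ʳ rewrite splitAt-↑ʳ (numPairs n) n j = refl
pairAt-surjective (suc n) {suc i} {suc j} (s<s i<j) with s , eq ← pairAt-surjective n i<j = s ↑ˡ n , pairAt-↑ˡ
  where
    pairAt-↑ˡ : pairAt (suc n) (s ↑ˡ n) ≡ (suc i , suc j)
    pairAt-↑ˡ rewrite splitAt-↑ˡ (numPairs n) s n | eq = refl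

pairIndex : {a b : Fin n} → a ≢ b → ∃ λ t → pairAt n t ≅ (a , b)
pairIndex {n} {a} {b} a≢b with <-cmp a b
... | tri< a<b _ _ = let t , eq = pairAt-surjective n a<b in t , inj₁ eq
... | tri≈ _ a≡b _ = ⊥-elim (a≢b a≡b)
... | tri> _ _ b<a = let t , eq = pairAt-surjective n b<a in t , inj₂ eq

pairAt-≅-injective : ∀ {s t e} → pairAt n s ≅ e → pairAt n t ≅ e → s ≡ t
pairAt-≅-injective {n} (inj₁ eq) (inj₁ eq′) = pairAt-injective n (trans eq (sym eq′))
pairAt-≅-injective {n} (inj₂ eq) (inj₂ eq′) = pairAt-injective n (trans eq (sym eq′))
pairAt-≅-injective {n} {s} {t} (inj₁ refl) (inj₂ eq′) =
  ⊥-elim (<-asym (pairAt-< n s) (subst (λ (i , j) → i < j) eq′ (pairAt-< n t)))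
pairAt-≅-injective {n} {s} {t} (inj₂ refl) (inj₁ eq′) =
  ⊥-elim (<-asym (pairAt-< n s) (subst (λ (i , j) → i < j) eq′ (pairAt-< n t)))

pairAt-≅-≢ : ∀ {s t p q} → pairAt n s ≅ p → pairAt n t ≅ q → ¬ p ≅ q → s ≢ t
pairAt-≅-≢ s≅p t≅q p≇q refl = p≇q (≅-trans (≅-sym s≅p) t≅q)

module Coordinates (P : Fin (numPairs n) → Point n) where

  coordinate : Fin n × Fin n → Fin (numPairs n) → ℚ
  coordinate (i , j) t = b2q (P t i j)

  Annihilates : (Fin (numPairs n) → ℚ) → Fin n × Fin n → Set
  Annihilates c e = c · coordinate e ≡ 0ℚ

  Symmetric : Set
  Symmetric = ∀ t i j → P t i j ≡ P t j i

  Annihilates-≅ : Symmetric → ∀ c {p q} → p ≅ q → Annihilates c p → Annihilates c q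
  Annihilates-≅ _         _ (inj₁ refl) = id
  Annihilates-≅ symmetric c (inj₂ refl) = trans (sumℚ-cong λ t → cong (λ x → c t *ℚ b2q x) (symmetric t _ _))

  Annihilates-+ : ∀ c {p q r} → (∀ t → coordinate p t ≡ coordinate q t +ℚ coordinate r t) →
                  Annihilates c q → Annihilates c r → Annihilates c p
  Annihilates-+ c {p} {q} {r} p≡q+r c⊥q c⊥r = begin
    c · coordinate p                              ≡⟨ sumℚ-cong (λ t → cong (c t *ℚ_) (p≡q+r t)) ⟩
    c · (λ t → coordinate q t +ℚ coordinate r t)  ≡⟨ ·-+ c (coordinate q) (coordinate r) ⟩
    c · coordinate q +ℚ c · coordinate r          ≡⟨ cong₂ _+ℚ_ c⊥q c⊥r ⟩
    0ℚ                                            ∎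
    where open ≡-Reasoning

  -- The all-ones row and the rows of the m − 2 other coordinates form an underdetermined system.
  dependentCoordinates⇒¬AffinelyIndependent :
    ∀ {e₁ e₂} → e₁ ≢ e₂ →
    (∀ c → sumℚ c ≡ 0ℚ → (∀ s → s ≢ e₁ → s ≢ e₂ → Annihilates c (pairAt n s)) →
       Annihilates c (pairAt n e₁) × Annihilates c (pairAt n e₂)) →
    ¬ AffinelyIndependent P
  dependentCoordinates⇒¬AffinelyIndependent {e₁} {e₂} e₁≢e₂ determined independent =
    refute (underdetermined⇒nonzeroSolution (numPairs n) rows fewerRows)
    where
      without : Fin (numPairs n) → List (Fin (numPairs n)) → List (Fin (numPairs n))
      without e = filter (λ s → ¬? (s ≟ e))

      others : List (Fin (numPairs n))
      others = without e₂ (without e₁ (allFin (numPairs n)))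

      rows : List (Fin (numPairs n) → ℚ)
      rows = (λ _ → 1ℚ) ∷ map (coordinate ∘ pairAt n) others

      fewerRows : length rows ℕ.< numPairs n
      fewerRows = begin-strict
        suc (length (map (coordinate ∘ pairAt n) others)) ≡⟨ cong suc (length-map _ others) ⟩
        suc (length others)                               ≤⟨ filter-notAll _ _ (Any.map (λ { refl s≢s → s≢s refl }) e₂∈) ⟩
        length (without e₁ (allFin (numPairs n)))         <⟨ filter-notAll _ _ (Any.map (λ { refl s≢s → s≢s refl }) (∈-allFin e₁)) ⟩
        length (allFin (numPairs n))                      ≡⟨ length-tabulate id ⟩
        numPairs n                                        ∎
        where
          open ≤-Reasoning
          e₂∈ : e₂ ∈ without e₁ (allFin (numPairs n))
          e₂∈ = ∈-filter⁺ _ (∈-allFin e₂) (e₁≢e₂ ∘ sym)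

      refute : NonzeroSolution rows → ⊥
      refute (c , (t₀ , cₜ₀≢0) , c⊥1 All.∷ c⊥rows) = cₜ₀≢0 (independent c Σc≡0 (λ _ _ → c⊥pair) t₀)
        where
          Σc≡0 : sumℚ c ≡ 0ℚ
          Σc≡0 = trans (sumℚ-cong λ t → sym (*-identityʳ (c t))) c⊥1

          c⊥others : ∀ s → s ≢ e₁ → s ≢ e₂ → Annihilates c (pairAt n s)
          c⊥others s s≢e₁ s≢e₂ = All.lookup (All.map⁻ c⊥rows) (∈-filter⁺ _ (∈-filter⁺ _ (∈-allFin s) s≢e₁) s≢e₂)

          c⊥pairAt : ∀ s → Annihilates c (pairAt n s)
          c⊥pairAt s with s ≟ e₁ | s ≟ e₂
          ... | yes refl | _        = proj₁ (determined c Σc≡0 c⊥others)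
          ... | no _     | yes refl = proj₂ (determined c Σc≡0 c⊥others)
          ... | no s≢e₁  | no s≢e₂  = c⊥others s s≢e₁ s≢e₂

          c⊥pair : ∀ {i j} → i < j → Annihilates c (i , j)
          c⊥pair i<j with s , s↦ij ← pairAt-surjective n i<j = subst (Annihilates c) s↦ij (c⊥pairAt s)

-- Paths with three or more edges

module AtLeastThreeEdges {G : Graph n} {u u′ w x v : Fin n}
                         (e₁ : adj G u u′ ≡ true) (e₂ : adj G u′ w ≡ true) (e₃ : adj G w x ≡ true) (r : Walk G x v)
                         (unique : Unique (vertices (step e₁ (step e₂ (step e₃ r))))) where
  open Walks {G = G}

  v∈r : v ∈ vertices r
  v∈r = end∈vertices r

  u≢u′ : u ≢ u′
  u≢u′ = All.lookup (AllPairs.head unique) (here refl)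

  u≢w : u ≢ w
  u≢w = All.lookup (AllPairs.head unique) (there (here refl))

  u≢v : u ≢ v
  u≢v = All.lookup (AllPairs.head unique) (there (there v∈r))

  u′≢w : u′ ≢ w
  u′≢w = All.lookup (AllPairs.head (AllPairs.tail unique)) (here refl)

  u′≢v : u′ ≢ v
  u′≢v = All.lookup (AllPairs.head (AllPairs.tail unique)) (there v∈r)

  w≢v : w ≢ v
  w≢v = All.lookup (AllPairs.head (AllPairs.tail (AllPairs.tail unique))) v∈r

  u′→v : Path G u′ v
  u′→v = step e₂ (step e₃ r) , AllPairs.tail unique

  u→w : Path G u w
  u→w = step e₁ (step e₂ here) , (u≢u′ All.∷ u≢w All.∷ All.[]) ∷ (u′≢w All.∷ All.[]) ∷ All.[] ∷ []

  -- x_uu′ and x_u′w are never both 1, as x_u′w ≤ x_u′v and x_uu′ + x_u′v = x_uv ≤ 1.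
  tight⇒tight-uw : ∀ {y} → InX G y → b2n (y u v) ≡ b2n (y u u′) + b2n (y u′ v) →
                   b2n (y u w) ≡ b2n (y u u′) + b2n (y u′ w)
  tight⇒tight-uw {y} y∈X tight = b2n-squeeze (y u u′) (y u′ w) (y u w) disjoint upper (lower (here refl)) (lower (there (here refl)))
    where
      2≤ : ∀ {k} → 2 ≤ 2 + k
      2≤ = s≤s (s≤s z≤n)

      disjoint : b2n (y u u′) + b2n (y u′ w) ≤ 1
      disjoint = ≤-trans (+-monoʳ-≤ (b2n (y u u′)) (InX.cutLower y∈X u′→v 2≤ (here refl)))
                         (≤-trans (≤-reflexive (sym tight)) (b2n≤1 (y u v)))

      upper : b2n (y u w) ≤ b2n (y u u′) + b2n (y u′ w)
      upper = subst (b2n (y u w) ≤_) (cong (b2n (y u u′) +_) (ℕₚ.+-identityʳ _)) (InX.cutUpper y∈X u→w 2≤)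

      lower : ∀ {a b} → (a , b) ∈ edges (proj₁ u→w) → b2n (y a b) ≤ b2n (y u w)
      lower = InX.cutLower y∈X u→w 2≤

  ¬facet : ¬ FacetDefining G (λ y → b2n (y u v)) (λ y → b2n (y u u′) + b2n (y u′ v))
  ¬facet facet with P , P∈X , P-tight , independent ← FacetDefining.dimFace facet =
    dependentCoordinates⇒¬AffinelyIndependent (pairAt-≅-≢ uv≅ uw≅ uv≇uw) determined independent
    where
      open Coordinates P

      symmetric : Symmetric
      symmetric t = proj₁ (InX.isPoint (P∈X t))

      uv≅ : pairAt n (proj₁ (pairIndex u≢v)) ≅ (u , v)
      uv≅ = proj₂ (pairIndex u≢v)

      uw≅ : pairAt n (proj₁ (pairIndex u≢w)) ≅ (u , w)
      uw≅ = proj₂ (pairIndex u≢w)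

      uv≇uw : ¬ (u , v) ≅ (u , w)
      uv≇uw = fst∉⇒≇ (u≢v ∘ sym) (w≢v ∘ sym) ∘ ≅-swapˡ

      tight-uv : ∀ t → coordinate (u , v) t ≡ coordinate (u , u′) t +ℚ coordinate (u′ , v) t
      tight-uv t = b2q-+ (P t u u′) (P t u′ v) (P-tight t)

      tight-uw : ∀ t → coordinate (u , w) t ≡ coordinate (u , u′) t +ℚ coordinate (u′ , w) t
      tight-uw t = b2q-+ (P t u u′) (P t u′ w) (tight⇒tight-uw (P∈X t) (P-tight t))

      determined : ∀ c → sumℚ c ≡ 0ℚ →
                   (∀ s → s ≢ proj₁ (pairIndex u≢v) → s ≢ proj₁ (pairIndex u≢w) → Annihilates c (pairAt n s)) →
                   Annihilates c (pairAt n (proj₁ (pairIndex u≢v))) × Annihilates c (pairAt n (proj₁ (pairIndex u≢w)))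
      determined c _ c⊥others =
        Annihilates-≅ symmetric c (≅-sym uv≅) (Annihilates-+ c tight-uv c⊥uu′ c⊥u′v) ,
        Annihilates-≅ symmetric c (≅-sym uw≅) (Annihilates-+ c tight-uw c⊥uu′ c⊥u′w)
        where
          c⊥other : ∀ {a b} → a ≢ b → ¬ (a , b) ≅ (u , v) → ¬ (a , b) ≅ (u , w) → Annihilates c (a , b)
          c⊥other a≢b ≇uv ≇uw with s , s≅ ← pairIndex a≢b =
            Annihilates-≅ symmetric c s≅ (c⊥others s (pairAt-≅-≢ s≅ uv≅ ≇uv) (pairAt-≅-≢ s≅ uw≅ ≇uw))

          u′∉uv : ∀ {b} → ¬ (u′ , b) ≅ (u , v)
          u′∉uv = fst∉⇒≇ (u≢u′ ∘ sym) u′≢v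

          u′∉uw : ∀ {b} → ¬ (u′ , b) ≅ (u , w)
          u′∉uw = fst∉⇒≇ (u≢u′ ∘ sym) u′≢w

          c⊥uu′ : Annihilates c (u , u′)
          c⊥uu′ = c⊥other u≢u′ (u′∉uv ∘ ≅-swapˡ) (u′∉uw ∘ ≅-swapˡ)

          c⊥u′v : Annihilates c (u′ , v)
          c⊥u′v = c⊥other u′≢v u′∉uv u′∉uw

          c⊥u′w : Annihilates c (u′ , w)
          c⊥u′w = c⊥other u′≢w u′∉uv u′∉uw

-- Paths with two edges

module TwoEdges {G : Graph n} (tree : IsTree G) {u w v : Fin n}
                (e₁ : adj G u w ≡ true) (e₂ : adj G w v ≡ true)
                (unique : Unique (vertices {G = G} (step e₁ (step e₂ here)))) where
  open IsTree tree
  open Walks {G = G}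
  open Tree tree

  u→v : Path G u v
  u→v = step e₁ (step e₂ here) , unique

  u≢v : u ≢ v
  u≢v = LongPath.a≢b e₁ here e₂ unique

  tuv : Fin (numPairs n)
  tuv = proj₁ (pairIndex u≢v)

  tuv≅ : pairAt n tuv ≅ (u , v)
  tuv≅ = proj₂ (pairIndex u≢v)

  edgeSet : Fin (numPairs n) → EdgeSet n
  edgeSet t with t ≟ tuv
  ... | yes _ = λ _ _ → false
  ... | no _  = endEdges (proj₁ (pairAt n t)) (proj₂ (pairAt n t))

  edgeSet-uv : ∀ x y → edgeSet tuv x y ≡ false
  edgeSet-uv x y with tuv ≟ tuv
  ... | yes _      = refl
  ... | no tuv≢tuv = ⊥-elim (tuv≢tuv refl)

  edgeSet-≢ : ∀ {t} → t ≢ tuv → ∀ x y → edgeSet t x y ≡ endEdges (proj₁ (pairAt n t)) (proj₂ (pairAt n t)) x y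
  edgeSet-≢ {t} t≢tuv x y with t ≟ tuv
  ... | yes t≡tuv = ⊥-elim (t≢tuv t≡tuv)
  ... | no _      = refl

  edgeSet-undirected : ∀ t → Undirected (edgeSet t)
  edgeSet-undirected t x y with t ≟ tuv
  ... | yes _ = refl
  ... | no _  = endEdges-undirected _ _ x y

  edgeSet⇒≢ : ∀ t {x y} → edgeSet t x y ≡ true → t ≢ tuv
  edgeSet⇒≢ _ {x} {y} xy∈ refl with () ← trans (sym xy∈) (edgeSet-uv x y)

  bothEnds⇒pair :
    ∀ t {a a⁺ b⁻ b} (eA : adj G a a⁺ ≡ true) (mid : Walk G a⁺ b⁻) (eB : adj G b⁻ b ≡ true) →
    Unique (vertices (step eA (snoc mid eB))) →
    edgeSet t a a⁺ ≡ true → edgeSet t b⁻ b ≡ true → pairAt n t ≅ (a , b)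
  bothEnds⇒pair t {a} {a⁺} {b⁻} {b} eA mid eB uR endA endB =
    endEdges⇒sameEnds eA mid eB uR (pairAt-≢ n t) (trans (sym (edgeSet-≢ t≢tuv a a⁺)) endA) (trans (sym (edgeSet-≢ t≢tuv b⁻ b)) endB)
    where
      t≢tuv : t ≢ tuv
      t≢tuv = edgeSet⇒≢ t endA

  P : Fin (numPairs n) → Point n
  P t = cutPoint (edgeSet t)

  P∈X : ∀ t → InX G (P t)
  P∈X t = cutPoint∈X (edgeSet t) (edgeSet-undirected t)

  P-tight : ∀ t → b2n (P t u v) ≡ b2n (P t u w) + b2n (P t w v)
  P-tight t rewrite cutPoint-path (edgeSet t) u→v | cutPoint-edge (edgeSet t) e₁ | cutPoint-edge (edgeSet t) e₂
                  | ∨-identityʳ (edgeSet t w v) =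
    b2n-∨-disjoint (edgeSet t u w) (edgeSet t w v) λ uw∈ wv∈ →
      edgeSet⇒≢ t uw∈ (pairAt-≅-injective (bothEnds⇒pair t e₁ here e₂ unique uw∈ wv∈) tuv≅)

  valid : ∀ x → InX G x → b2n (x u v) ≤ b2n (x u w) + b2n (x w v)
  valid x x∈X = subst (b2n (x u v) ≤_) (cong (b2n (x u w) +_) (ℕₚ.+-identityʳ _)) (InX.cutUpper x∈X u→v (s≤s (s≤s z≤n)))

  proper : ∃ λ x → InX G x × b2n (x u v) ≢ b2n (x u w) + b2n (x w v)
  proper = cutPoint everything , cutPoint∈X everything (λ _ _ → refl) , 1≢2
    where
      everything : EdgeSet n
      everything _ _ = true

      1≢2 : b2n (cutPoint everything u v) ≢ b2n (cutPoint everything u w) + b2n (cutPoint everything w v)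
      1≢2 rewrite cutPoint-path everything u→v | cutPoint-edge everything e₁ | cutPoint-edge everything e₂ = λ ()

  module Independence (c : Fin (numPairs n) → ℚ) (Σc≡0 : sumℚ c ≡ 0ℚ)
                      (c⊥ : ∀ i j → i < j → sumℚ (λ t → c t *ℚ b2q (P t i j)) ≡ 0ℚ) where
    open Coordinates P

    symmetric : Symmetric
    symmetric t = cutPoint-sym (edgeSet t) (edgeSet-undirected t)

    c⊥all : ∀ i j → Annihilates c (i , j)
    c⊥all i j with <-cmp i j
    ... | tri< i<j _ _  = c⊥ i j i<j
    ... | tri≈ _ refl _ = sumℚ-zero λ t → trans (cong (λ x → c t *ℚ b2q x) (cutPoint-diag (edgeSet t) i)) (*-zeroʳ (c t))
    ... | tri> _ _ j<i  = Annihilates-≅ symmetric c (inj₂ refl) (c⊥ j i j<i)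

    module LongPair (t₀ : Fin (numPairs n)) (t₀≢tuv : t₀ ≢ tuv) {a⁺ b⁻ : Fin n}
                    (eA : adj G (proj₁ (pairAt n t₀)) a⁺ ≡ true) (mid : Walk G a⁺ b⁻)
                    (eB : adj G b⁻ (proj₂ (pairAt n t₀)) ≡ true)
                    (walk≡ : walk (proj₁ (pairAt n t₀)) (proj₂ (pairAt n t₀)) ≡ step eA (snoc mid eB)) where
      a b : Fin n
      a = proj₁ (pairAt n t₀)
      b = proj₂ (pairAt n t₀)

      uR : Unique (vertices (step eA (snoc mid eB)))
      uR = subst (Unique ∘ vertices) walk≡ (proj₂ (connected a b))

      module R = LongPath eA mid eB uR

      inner : EdgeSet n → Bool
      inner S = anyEdge S (edges mid)

      cut-ab : ∀ S → cutPoint S a b ≡ S a a⁺ ∨ (inner S ∨ S b⁻ b)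
      cut-ab S = trans (cutPoint-path S R.whole)
                       (cong (S a a⁺ ∨_) (trans (cong (anyEdge S) (edges-snoc mid eB)) (anyEdge-snoc S (edges mid) b⁻ b)))

      cut-a⁺b : ∀ S → cutPoint S a⁺ b ≡ inner S ∨ S b⁻ b
      cut-a⁺b S = trans (cutPoint-path S R.tailPath) (trans (cong (anyEdge S) (edges-snoc mid eB)) (anyEdge-snoc S (edges mid) b⁻ b))

      cut-ab⁻ : ∀ S → cutPoint S a b⁻ ≡ S a a⁺ ∨ inner S
      cut-ab⁻ S = cutPoint-path S R.initPath

      cut-a⁺b⁻ : ∀ S → cutPoint S a⁺ b⁻ ≡ inner S
      cut-a⁺b⁻ S = cutPoint-path S R.midPath

      -- x_ab + x_a⁺b⁻ − x_a⁺b − x_ab⁻ = −[S cuts aa⁺ and b⁻b but no edge in between].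
      separated : Fin (numPairs n) → Bool
      separated t = edgeSet t a a⁺ ∧ (edgeSet t b⁻ b ∧ not (inner (edgeSet t)))

      relation : ∀ t → b2q (cutPoint (edgeSet t) a b) +ℚ b2q (cutPoint (edgeSet t) a⁺ b⁻) +ℚ b2q (separated t)
                     ≡ b2q (cutPoint (edgeSet t) a⁺ b) +ℚ b2q (cutPoint (edgeSet t) a b⁻)
      relation t rewrite cut-ab (edgeSet t) | cut-a⁺b (edgeSet t) | cut-ab⁻ (edgeSet t) | cut-a⁺b⁻ (edgeSet t) =
        b2q-inclusion-exclusion (edgeSet t a a⁺) (inner (edgeSet t)) (edgeSet t b⁻ b)

      endEdge∈edgeSet : ∀ {x y} → (x , y) ≅ (a , a⁺) ⊎ (x , y) ≅ (b⁻ , b) → edgeSet t₀ x y ≡ true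
      endEdge∈edgeSet {x} {y} end =
        trans (edgeSet-≢ t₀≢tuv x y) (endEdges⁺ (subst (λ q → EndEdge q (x , y)) (sym walk≡) (EndEdge-long⁺ eA mid eB end)))

      midEdge∉edgeSet : ∀ {x y} → (x , y) ∈ edges mid → edgeSet t₀ x y ≡ false
      midEdge∉edgeSet {x} {y} xy∈ with edgeSet t₀ x y in xy∈S
      ... | false = refl
      ... | true  = ⊥-elim (touchesEnd (EndEdge-long⁻ eA mid eB (subst (λ q → EndEdge q (x , y)) walk≡
                                         (endEdges⁻ (trans (sym (edgeSet-≢ t₀≢tuv x y)) xy∈S)))))
        where
          x∈ : x ∈ vertices mid
          x∈ = proj₁ (∈-edges⇒∈-vertices mid xy∈)

          y∈ : y ∈ vertices mid
          y∈ = proj₂ (∈-edges⇒∈-vertices mid xy∈)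

          touchesEnd : (x , y) ≅ (a , a⁺) ⊎ (x , y) ≅ (b⁻ , b) → ⊥
          touchesEnd (inj₁ (inj₁ refl)) = R.a∉mid x∈
          touchesEnd (inj₁ (inj₂ refl)) = R.a∉mid y∈
          touchesEnd (inj₂ (inj₁ refl)) = R.b∉mid y∈
          touchesEnd (inj₂ (inj₂ refl)) = R.b∉mid x∈

      separated-t₀ : separated t₀ ≡ true
      separated-t₀ rewrite endEdge∈edgeSet (inj₁ (inj₁ refl)) | endEdge∈edgeSet (inj₂ (inj₁ refl))
                         | anyEdge-false (edgeSet t₀) (edges mid) midEdge∉edgeSet = refl

      separated-≢ : ∀ t → t ≢ t₀ → separated t ≡ false
      separated-≢ t t≢t₀ = ∧-disjoint (edgeSet t a a⁺) (edgeSet t b⁻ b) _ λ endA endB →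
        t≢t₀ (pairAt-≅-injective (bothEnds⇒pair t eA mid eB uR endA endB) (inj₁ refl))

      c₀≡0 : c t₀ ≡ 0ℚ
      c₀≡0 = ·-isolate c (b2q ∘ separated) t₀
               (λ t t≢t₀ → trans (cong (λ x → c t *ℚ b2q x) (separated-≢ t t≢t₀)) (*-zeroʳ (c t)))
               (cong b2q separated-t₀)
               (·-relation c (coordinate (a , b)) (coordinate (a⁺ , b⁻)) (b2q ∘ separated) (coordinate (a⁺ , b)) (coordinate (a , b⁻))
                  relation (c⊥all a b) (c⊥all a⁺ b⁻) (c⊥all a⁺ b) (c⊥all a b⁻))

    edgeSet-edge : ∀ t {x y} (e : adj G (proj₁ (pairAt n t)) (proj₂ (pairAt n t)) ≡ true) →
                   walk (proj₁ (pairAt n t)) (proj₂ (pairAt n t)) ≡ step e here →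
                   edgeSet t x y ≡ true → pairAt n t ≅ (x , y)
    edgeSet-edge t {x} {y} e walk≡ xy∈ =
      ≅-sym (EndEdge-edge e (subst (λ q → EndEdge q (x , y)) walk≡
        (endEdges⁻ (trans (sym (edgeSet-≢ (edgeSet⇒≢ t xy∈) x y)) xy∈))))

    module EdgePair (t₀ : Fin (numPairs n)) (t₀≢tuv : t₀ ≢ tuv)
                    (e : adj G (proj₁ (pairAt n t₀)) (proj₂ (pairAt n t₀)) ≡ true)
                    (walk≡ : walk (proj₁ (pairAt n t₀)) (proj₂ (pairAt n t₀)) ≡ step e here) where
      a b : Fin n
      a = proj₁ (pairAt n t₀)
      b = proj₂ (pairAt n t₀)

      -- Long pairs already have coefficient 0, and among the edge pairs only t₀ cuts ab.
      others : ∀ t → t ≢ t₀ → c t *ℚ coordinate (a , b) t ≡ 0ℚ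
      others t t≢t₀ = byCases (t ≟ tuv)
        where
          ab∉ : edgeSet t a b ≡ false → c t *ℚ coordinate (a , b) t ≡ 0ℚ
          ab∉ ab∉S = trans (cong (λ x → c t *ℚ b2q x) (trans (cutPoint-edge (edgeSet t) e) ab∉S)) (*-zeroʳ (c t))

          byCases : Dec (t ≡ tuv) → c t *ℚ coordinate (a , b) t ≡ 0ℚ
          byCases (yes refl) = ab∉ (edgeSet-uv a b)
          byCases (no t≢tuv) with shape (walk (proj₁ (pairAt n t)) (proj₂ (pairAt n t))) (pairAt-≢ n t)
          ... | long eA mid eB walk≡′ =
            trans (cong (_*ℚ coordinate (a , b) t) (LongPair.c₀≡0 t t≢tuv eA mid eB walk≡′)) (*-zeroˡ (coordinate (a , b) t))
          ... | edge e′ walk≡′ with edgeSet t a b in ab∈S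
          ...   | false = ab∉ ab∈S
          ...   | true  = ⊥-elim (t≢t₀ (pairAt-≅-injective (edgeSet-edge t e′ walk≡′ ab∈S) (inj₁ refl)))

      c₀≡0 : c t₀ ≡ 0ℚ
      c₀≡0 = ·-isolate c (coordinate (a , b)) t₀ others
               (cong b2q (trans (cutPoint-edge (edgeSet t₀) e) (trans (edgeSet-≢ t₀≢tuv a b)
                 (endEdges⁺ (subst (λ q → EndEdge q (a , b)) (sym walk≡) (inj₁ (inj₁ refl)))))))
               (c⊥all a b)

    c≢uv≡0 : ∀ t → t ≢ tuv → c t ≡ 0ℚ
    c≢uv≡0 t t≢tuv with shape (walk (proj₁ (pairAt n t)) (proj₂ (pairAt n t))) (pairAt-≢ n t)
    ... | edge e walk≡         = EdgePair.c₀≡0 t t≢tuv e walk≡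
    ... | long eA mid eB walk≡ = LongPair.c₀≡0 t t≢tuv eA mid eB walk≡

    c≡0 : ∀ t → c t ≡ 0ℚ
    c≡0 t with t ≟ tuv
    ... | no t≢tuv = c≢uv≡0 t t≢tuv
    ... | yes refl = ·-isolate c (λ _ → 1ℚ) tuv
                       (λ t t≢tuv → trans (cong (_*ℚ 1ℚ) (c≢uv≡0 t t≢tuv)) (*-zeroˡ 1ℚ)) refl
                       (trans (sumℚ-cong λ t → *-identityʳ (c t)) Σc≡0)

  facet : FacetDefining G (λ x → b2n (x u v)) (λ x → b2n (x u w) + b2n (x w v))
  facet = record
    { valid   = valid
    ; proper  = proper
    ; dimFace = P , P∈X , P-tight , Independence.c≡0
    }

facet⇒length≡2 : {G : Graph n} {u v : Fin n} (p : Path G u v) → 2 ≤ len (proj₁ p) →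
                 FacetDefining G (λ x → b2n (x u v)) (λ x → b2n (x u (second (proj₁ p))) + b2n (x (second (proj₁ p)) v)) →
                 len (proj₁ p) ≡ 2
facet⇒length≡2 (here , _)                                 ()
facet⇒length≡2 (step _ here , _)                          (s≤s ())
facet⇒length≡2 (step _ (step _ here) , _)                 _ _     = refl
facet⇒length≡2 (step e₁ (step e₂ (step e₃ r)) , unique) _ facet = ⊥-elim (AtLeastThreeEdges.¬facet e₁ e₂ e₃ r unique facet)

length≡2⇒facet : {G : Graph n} → IsTree G → {u v : Fin n} (p : Path G u v) → len (proj₁ p) ≡ 2 →
                 FacetDefining G (λ x → b2n (x u v)) (λ x → b2n (x u (second (proj₁ p))) + b2n (x (second (proj₁ p)) v))
length≡2⇒facet tree (step e₁ (step e₂ here) , unique) refl = TwoEdges.facet tree e₁ e₂ unique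

lemma5 : (n : ℕ) (G : Graph n) → IsTree G →
         (u v : Fin n) (p : Path G u v) → 2 ≤ len (proj₁ p) →
         FacetDefining G
           (λ x → b2n (x u v))
           (λ x → b2n (x u (second (proj₁ p))) + b2n (x (second (proj₁ p)) v))
         ⇔ (len (proj₁ p) ≡ 2)
lemma5 n G tree u v p 2≤len = mk⇔ (facet⇒length≡2 p 2≤len) (length≡2⇒facet tree p)
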